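{- If $G$ is a $(3,2)$-critical graph that contains at least three odd cycles, then there exist two odd cycles of $G$ whose intersection is a path with at least one edge.
   Context: Graphs are finite, simple and without isolated vertices. $\chi(G)$ is the chromatic number. ${\rm es}_{\chi}(G)$ is the minimum number of edges of $G$ whose removal results in a spanning subgraph $G_1$ with $\chi(G_1)=\chi(G)-1$. $G$ is $(3,2)$-critical if $\chi(G)=3$, ${\rm es}_{\chi}(G)=2$, and ${\rm es}_{\chi}(G-e)<{\rm es}_{\chi}(G)$ for every edge $e$. Odd cycles are cycle subgraphs of odd length. -}

module Defs where

open import Data.Nat using (ℕ; zero; suc; _+_; _*_; _∸_; _≤_; _<_)
open import Data.Nat.DivMod using (_mod_)
open import Data.Fin as F using (Fin; toℕ; inject₁)
open import Data.Product using (Σ; ∃; ∃-syntax; _×_; _,_)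
open import Data.Sum using (_⊎_)
open import Data.List using (List; length; removeAt)
open import Data.List.Membership.Propositional using (_∈_)
open import Data.List.Relation.Unary.Unique.Propositional using (Unique)
open import Data.List.Relation.Binary.Sublist.Propositional using (_⊆_)
open import Function.Definitions using (Injective)
open import Function.Bundles using (_⇔_)
open import Relation.Binary.PropositionalEquality using (_≡_; _≢_)
open import Relation.Nullary using (¬_)

-- A graph on vertex set Fin n is given by its edge list; each edge {u,v}
-- is stored once as the pair (u , v) with u < v.
EdgeList : ℕ → Set
EdgeList n = List (Fin n × Fin n)

Adj : ∀ {n} → EdgeList n → Fin n → Fin n → Set
Adj E u v = ((u , v) ∈ E) ⊎ ((v , u) ∈ E)

record IsGraph {n : ℕ} (E : EdgeList n) : Set where
  field
    ordered      : ∀ {u v} → (u , v) ∈ E → u F.< v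
    noDup        : Unique E
    noIsolated   : ∀ v → ∃[ u ] Adj E v u

Colorable : ∀ {n} → ℕ → EdgeList n → Set
Colorable {n} k E = Σ (Fin n → Fin k) λ c → (∀ {u v} → (u , v) ∈ E → c u ≢ c v)

IsChromatic : ∀ {n} → EdgeList n → ℕ → Set
IsChromatic E k = Colorable k E × (∀ m → Colorable m E → k ≤ m)

Reduces : ∀ {n} → EdgeList n → EdgeList n → Set
Reduces E E₁ = (E₁ ⊆ E) × ∃[ k ] (IsChromatic E k × IsChromatic E₁ (k ∸ 1))

IsEsChi : ∀ {n} → EdgeList n → ℕ → Set
IsEsChi E m =
  (∃[ E₁ ] (Reduces E E₁ × length E ∸ length E₁ ≡ m))
  × (∀ E₁ → Reduces E E₁ → m ≤ length E ∸ length E₁)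

-- (3,2)-critical graph; G - e is  removeAt E i
Critical32 : ∀ {n} → EdgeList n → Set
Critical32 E =
  IsChromatic E 3 × IsEsChi E 2
  × (∀ (i : Fin (length E)) → ∃[ m ] (IsEsChi (removeAt E i) m × m < 2))

Odd : ℕ → Set
Odd k = ∃[ j ] (k ≡ suc (2 * j))

next : ∀ {k} → Fin (suc k) → Fin (suc k)
next {k} i = suc (toℕ i) mod (suc k)

record Cycle {n : ℕ} (E : EdgeList n) : Set where
  field
    m     : ℕ
    vert  : Fin (3 + m) → Fin n
    inj   : Injective _≡_ _≡_ vert
    adj   : ∀ i → Adj E (vert i) (vert (next i))

  len : ℕ
  len = 3 + m

open Cycle public

CycV : ∀ {n} {E : EdgeList n} → Cycle E → Fin n → Set
CycV C v = ∃[ i ] (vert C i ≡ v)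

CycE : ∀ {n} {E : EdgeList n} → Cycle E → Fin n → Fin n → Set
CycE C u v = ∃[ i ] ((vert C i ≡ u × vert C (next i) ≡ v)
                    ⊎ (vert C i ≡ v × vert C (next i) ≡ u))

OddCycle : ∀ {n} → EdgeList n → Set
OddCycle E = Σ (Cycle E) (λ C → Odd (len C))

-- two cycles are the same subgraph iff they have the same edge set
-- (hence also the same vertex set)
SameSubgraph : ∀ {n} {E : EdgeList n} → Cycle E → Cycle E → Set
SameSubgraph C D = (∀ u v → CycE C u v ⇔ CycE D u v)

IntersectionIsNontrivialPath : ∀ {n} {E : EdgeList n} → Cycle E → Cycle E → Set
IntersectionIsNontrivialPath {n} C D =
  ∃[ ℓ ] Σ (Fin (suc (suc ℓ)) → Fin n) λ p →
      Injective _≡_ _≡_ p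
    × (∀ v → (CycV C v × CycV D v) ⇔ (∃[ j ] (p j ≡ v)))
    × (∀ u v → (CycE C u v × CycE D u v) ⇔
          (∃[ j ] ((p (inject₁ j) ≡ u × p (F.suc j) ≡ v)
                 ⊎ (p (inject₁ j) ≡ v × p (F.suc j) ≡ u))))

module Submission where

-- Let e be an edge of the odd cycle X₁.  If X₂ or X₃ uses e, two
-- distinct odd cycles share an edge.  Otherwise, as es_χ(G - e) ≤ 1, deleting
-- e and at most one more edge f leaves a bipartite graph; so every odd cycle
-- avoiding e passes through f, and X₂, X₃ share the edge f.
-- Two distinct cycles sharing an edge differ in an edge, so one of them, D,
-- leaves the other, C.  Following D from the shared edge to its first step
-- off C and on to its next vertex on C gives an ear of C: a path with both
-- ends on C, interior off C and no edge of C.  Its ends cut C into two arcs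
-- whose lengths add up to the odd length of C, so the ear closes with one of
-- them into an odd cycle Q, and C ∩ Q is exactly that arc.

open import Defs
open import Data.Nat using (ℕ)
open import Data.Product using (Σ; _×_; proj₁)
open import Relation.Nullary using (¬_)

open import Data.Nat using (zero; suc; _+_; _*_; _∸_; _≤_; _<_; z≤n; s≤s; s≤s⁻¹; NonZero; _%_; _≤?_; _<?_)
open import Data.Nat.Properties
open import Data.Nat.DivMod using (_mod_; m%n<n; m%n%n≡m%n; [m+n]%n≡m%n; %-distribˡ-+; m<n⇒m%n≡m; m≤n⇒[n∸m]%m≡n%m; n%n≡0)
open import Data.Nat.Solver using (module +-*-Solver)
open import Data.Fin as F using (Fin; toℕ)
open import Data.Fin.Properties using (toℕ-fromℕ<; toℕ-fromℕ; toℕ-injective; toℕ<n; toℕ-inject₁; inject≤-injective; any?; all?; ¬∀⟶∃¬)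
open import Data.List using (List; _∷_; length; removeAt; lookup)
open import Data.List.Membership.Propositional using (_∈_)
open import Data.List.Relation.Unary.Any using (here; there; index)
open import Data.List.Relation.Unary.Any.Properties using (lookup-index)
open import Data.List.Relation.Binary.Sublist.Propositional using (_⊆_; []; _∷_; _∷ʳ_)
open import Data.List.Relation.Binary.Sublist.Heterogeneous.Properties using (length-mono-≤; toPointwise)
open import Data.List.Relation.Binary.Pointwise using (Pointwise-≡⇒≡)
open import Data.Product using (∃-syntax; _,_; proj₂)
open import Data.Product.Properties using (≡-dec)
open import Data.Sum using (_⊎_; inj₁; inj₂)
open import Data.Empty using (⊥; ⊥-elim)
open import Function.Bundles using (_⇔_; mk⇔)
open import Relation.Binary.PropositionalEquality
open import Relation.Nullary using (Dec; yes; no)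
open import Relation.Nullary.Decidable using (_×-dec_; _⊎-dec_; ¬?; decidable-stable)

SamePair : ∀ {n} → Fin n → Fin n → Fin n → Fin n → Set
SamePair x y u v = (x ≡ u × y ≡ v) ⊎ (x ≡ v × y ≡ u)

same-pair-subst : ∀ {n} {x y x' y' u v : Fin n} → x ≡ x' → y ≡ y' → SamePair x y u v → SamePair x' y' u v
same-pair-subst refl refl p = p

OddCyclesMeetInPath : ∀ {n} → EdgeList n → Set
OddCyclesMeetInPath E =
  Σ (OddCycle E) λ D₁ → Σ (OddCycle E) λ D₂ → IntersectionIsNontrivialPath (proj₁ D₁) (proj₁ D₂)

injective-by-symmetry : ∀ {A : Set} (f : ℕ → A) (P : ℕ → Set)
  → (∀ x y → x ≤ y → P x → P y → f x ≡ f y → x ≡ y)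
  → ∀ x y → P x → P y → f x ≡ f y → x ≡ y
injective-by-symmetry f P ordered x y px py e with ≤-total x y
... | inj₁ x≤y = ordered x y x≤y px py e
... | inj₂ y≤x = sym (ordered y x y≤x py px (sym e))

module Residues (L : ℕ) .{{_ : NonZero L}} where

  %-absorbʳ : ∀ x y → (x + y % L) % L ≡ (x + y) % L
  %-absorbʳ x y = begin
    (x + y % L) % L         ≡⟨ %-distribˡ-+ x (y % L) L ⟩
    (x % L + y % L % L) % L ≡⟨ cong (λ z → (x % L + z) % L) (m%n%n≡m%n y L) ⟩
    (x % L + y % L) % L     ≡⟨ %-distribˡ-+ x y L ⟨
    (x + y) % L             ∎
    where open ≡-Reasoning

  %-absorbˡ : ∀ x y → (x % L + y) % L ≡ (x + y) % L
  %-absorbˡ x y = begin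
    (x % L + y) % L ≡⟨ cong (_% L) (+-comm (x % L) y) ⟩
    (y + x % L) % L ≡⟨ %-absorbʳ y x ⟩
    (y + x) % L     ≡⟨ cong (_% L) (+-comm y x) ⟩
    (x + y) % L     ∎
    where open ≡-Reasoning

  suc-cong : ∀ x y → x % L ≡ y % L → suc x % L ≡ suc y % L
  suc-cong x y e = begin
    suc x % L       ≡⟨ %-absorbʳ 1 x ⟨
    suc (x % L) % L ≡⟨ cong (λ z → suc z % L) e ⟩
    suc (y % L) % L ≡⟨ %-absorbʳ 1 y ⟩
    suc y % L       ∎
    where open ≡-Reasoning

  no-return : ∀ x d → d < L → (x + d) % L ≡ x % L → d ≡ 0
  no-return x d d<L e = reduced (x % L) (m%n<n x L) (trans (%-absorbˡ x d) e)
    where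
      reduced : ∀ a → a < L → (a + d) % L ≡ a → d ≡ 0
      reduced a a<L e' with a + d <? L
      ... | yes a+d<L = +-cancelˡ-≡ a d 0 (begin
              a + d       ≡⟨ m<n⇒m%n≡m a+d<L ⟨
              (a + d) % L ≡⟨ e' ⟩
              a           ≡⟨ +-identityʳ a ⟨
              a + 0       ∎)
        where open ≡-Reasoning
      ... | no a+d≮L = ⊥-elim (<-irrefl d≡L d<L)
        where
          L≤a+d : L ≤ a + d
          L≤a+d = ≮⇒≥ a+d≮L
          wrapped< : a + d ∸ L < L
          wrapped< = begin-strict
            a + d ∸ L ≤⟨ ∸-monoˡ-≤ L (+-monoʳ-≤ a (<⇒≤ d<L)) ⟩
            a + L ∸ L ≡⟨ m+n∸n≡m a L ⟩
            a         <⟨ a<L ⟩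
            L         ∎
            where open ≤-Reasoning
          wrapped : a + d ∸ L ≡ a
          wrapped = trans (sym (m<n⇒m%n≡m wrapped<)) (trans (m≤n⇒[n∸m]%m≡n%m L≤a+d) e')
          d≡L : d ≡ L
          d≡L = +-cancelˡ-≡ a d L (trans (sym (m∸n+n≡m L≤a+d)) (cong (_+ L) wrapped))

  offset-injective : ∀ a x y → x < L → y < L → (a + x) % L ≡ (a + y) % L → x ≡ y
  offset-injective a = injective-by-symmetry (λ x → (a + x) % L) (_< L) ordered
    where
      ordered : ∀ x y → x ≤ y → x < L → y < L → (a + x) % L ≡ (a + y) % L → x ≡ y
      ordered x y x≤y _ y<L e = ≤-antisym x≤y (m∸n≡0⇒m≤n gap≡0)
        where
          open ≡-Reasoning
          gap≡0 : y ∸ x ≡ 0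
          gap≡0 = no-return (a + x) (y ∸ x) (≤-<-trans (m∸n≤m y x) y<L) (begin
            (a + x + (y ∸ x)) % L   ≡⟨ cong (_% L) (+-assoc a x (y ∸ x)) ⟩
            (a + (x + (y ∸ x))) % L ≡⟨ cong (λ z → (a + z) % L) (m+[n∸m]≡n x≤y) ⟩
            (a + y) % L             ≡⟨ e ⟨
            (a + x) % L             ∎)

  forward-step : ∀ x y → ∃[ d ] (d < L × (x + d) % L ≡ y % L)
  forward-step x y = d , m%n<n _ L , (begin
      (x + d) % L                         ≡⟨ %-absorbʳ x (y % L + (L ∸ x % L)) ⟩
      (x + (y % L + (L ∸ x % L))) % L     ≡⟨ %-absorbˡ x _ ⟨
      (x % L + (y % L + (L ∸ x % L))) % L ≡⟨ cong (_% L) (swap (x % L) (y % L) (L ∸ x % L)) ⟩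
      (y % L + (x % L + (L ∸ x % L))) % L ≡⟨ cong (λ z → (y % L + z) % L) (m+[n∸m]≡n (<⇒≤ (m%n<n x L))) ⟩
      (y % L + L) % L                     ≡⟨ [m+n]%n≡m%n (y % L) L ⟩
      y % L % L                           ≡⟨ m%n%n≡m%n y L ⟩
      y % L                               ∎)
    where
      open ≡-Reasoning
      d : ℕ
      d = (y % L + (L ∸ x % L)) % L
      swap : ∀ a b c → a + (b + c) ≡ b + (a + c)
      swap a b c = trans (sym (+-assoc a b c)) (trans (cong (_+ c) (+-comm a b)) (+-assoc b a c))

Even : ℕ → Set
Even k = ∃[ j ] (k ≡ 2 * j)

even-or-odd : ∀ k → Even k ⊎ Odd k
even-or-odd zero = inj₁ (0 , refl)
even-or-odd (suc k) with even-or-odd k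
... | inj₁ (j , k≡) = inj₂ (j , cong suc k≡)
... | inj₂ (j , k≡) = inj₁ (suc j , trans (cong suc k≡) (sym (*-suc 2 j)))

odd-split : ∀ a b → Odd (a + b) → Odd a ⊎ Odd b
odd-split a b (j , a+b≡) with even-or-odd a | even-or-odd b
... | _ | inj₂ odd-b = inj₂ odd-b
... | inj₂ odd-a | _ = inj₁ odd-a
... | inj₁ (i , a≡) | inj₁ (i' , b≡) =
  ⊥-elim (even≢odd (i + i') j (trans (*-distribˡ-+ 2 i i') (trans (sym (cong₂ _+_ a≡ b≡)) a+b≡)))

odd-≥3 : ∀ {k} → Odd k → 2 ≤ k → 3 ≤ k
odd-≥3 (zero , refl) (s≤s ())
odd-≥3 (suc j , refl) _ = s≤s (*-monoʳ-≤ 2 (s≤s (z≤n {j})))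

-- A path of length r whose ends cut an odd cycle of length L into arcs ℓ and
-- L - ℓ gives two closed routes of total length 2r + L, which is odd.
two-routes-odd : ∀ r ℓ L → ℓ ≤ L → Odd L → Odd ((r + ℓ) + (r + (L ∸ ℓ)))
two-routes-odd r ℓ L ℓ≤L (j , L≡) = r + j , (begin
    (r + ℓ) + (r + (L ∸ ℓ)) ≡⟨ regroup r ℓ (L ∸ ℓ) ⟩
    2 * r + (ℓ + (L ∸ ℓ))   ≡⟨ cong (2 * r +_) (m+[n∸m]≡n ℓ≤L) ⟩
    2 * r + L               ≡⟨ cong (2 * r +_) L≡ ⟩
    2 * r + suc (2 * j)     ≡⟨ +-suc (2 * r) (2 * j) ⟩
    suc (2 * r + 2 * j)     ≡⟨ cong suc (*-distribˡ-+ 2 r j) ⟨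
    suc (2 * (r + j))       ∎)
  where
    open ≡-Reasoning
    regroup : ∀ a b c → (a + b) + (a + c) ≡ 2 * a + (b + c)
    regroup = solve 3 (λ a b c → (a :+ b) :+ (a :+ c) := con 2 :* a :+ (b :+ c)) refl
      where open +-*-Solver

module _ {n : ℕ} {E : EdgeList n} (C : Cycle E) where

  CycV? : ∀ v → Dec (CycV C v)
  CycV? v = any? (λ i → vert C i F.≟ v)

  CycE? : ∀ u v → Dec (CycE C u v)
  CycE? u v = any? (λ i → ((vert C i F.≟ u) ×-dec (vert C (next i) F.≟ v))
                         ⊎-dec ((vert C i F.≟ v) ×-dec (vert C (next i) F.≟ u)))

  edge-ends : ∀ {u v} → CycE C u v → CycV C u × CycV C v
  edge-ends (i , inj₁ (a , b)) = (i , a) , (next i , b)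
  edge-ends (i , inj₂ (a , b)) = (next i , b) , (i , a)

  edge-sym : ∀ {u v} → CycE C u v → CycE C v u
  edge-sym (i , inj₁ p) = i , inj₂ p
  edge-sym (i , inj₂ p) = i , inj₁ p

  edge-of-pair : ∀ {x y u v} → SamePair x y u v → CycE C x y → CycE C u v
  edge-of-pair (inj₁ (refl , refl)) e = e
  edge-of-pair (inj₂ (refl , refl)) e = edge-sym e

-- A cycle C of length L read as an L-periodic walk indexed by ℕ: position x
-- is the vertex x mod L.  This avoids modular index arithmetic on Fin L.
module CycleWalk {n : ℕ} {E : EdgeList n} (C : Cycle E) where

  L : ℕ
  L = len C

  open Residues L public

  at : ℕ → Fin n
  at x = vert C (x mod L)

  private
    toℕ-mod : ∀ x → toℕ (x mod L) ≡ x % L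
    toℕ-mod x = toℕ-fromℕ< (m%n<n x L)

  at-cong : ∀ x y → x % L ≡ y % L → at x ≡ at y
  at-cong x y e = cong (vert C) (toℕ-injective (trans (toℕ-mod x) (trans e (sym (toℕ-mod y)))))

  at-residue : ∀ x y → at x ≡ at y → x % L ≡ y % L
  at-residue x y e = trans (sym (toℕ-mod x)) (trans (cong toℕ (inj C e)) (toℕ-mod y))

  at-periodic : ∀ x → at (x + L) ≡ at x
  at-periodic x = at-cong (x + L) x ([m+n]%n≡m%n x L)

  vert-at : ∀ i → vert C i ≡ at (toℕ i)
  vert-at i = cong (vert C) (toℕ-injective (sym (trans (toℕ-mod (toℕ i)) (m<n⇒m%n≡m (toℕ<n i)))))

  next-at : ∀ x → vert C (next (x mod L)) ≡ at (suc x)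
  next-at x = at-cong (suc (toℕ (x mod L))) (suc x)
                (trans (cong (λ z → suc z % L) (toℕ-mod x)) (%-absorbʳ 1 x))

  at-adj : ∀ x → Adj E (at x) (at (suc x))
  at-adj x = subst (Adj E (at x)) (next-at x) (adj C (x mod L))

  at-injective : ∀ a x y → x < L → y < L → at (a + x) ≡ at (a + y) → x ≡ y
  at-injective a x y x<L y<L e = offset-injective a x y x<L y<L (at-residue (a + x) (a + y) e)

  vertex-position : ∀ {v} → CycV C v → ∃[ x ] (at x ≡ v)
  vertex-position (i , e) = toℕ i , trans (sym (vert-at i)) e

  position-vertex : ∀ x → CycV C (at x)
  position-vertex x = x mod L , refl

  edge-step : ∀ {u v} → CycE C u v → ∃[ x ] SamePair (at x) (at (suc x)) u v
  edge-step (i , p) = toℕ i , same-pair-subst (vert-at i) refl p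

  step-edge : ∀ x {u v} → SamePair (at x) (at (suc x)) u v → CycE C u v
  step-edge x p = x mod L , same-pair-subst refl (sym (next-at x)) p

alternate : ∀ {a b c : Fin 2} → a ≢ b → b ≢ c → a ≡ c
alternate {F.zero} {F.zero} a≢b _ = ⊥-elim (a≢b refl)
alternate {F.suc F.zero} {F.suc F.zero} a≢b _ = ⊥-elim (a≢b refl)
alternate {_} {F.zero} {F.zero} _ b≢c = ⊥-elim (b≢c refl)
alternate {_} {F.suc F.zero} {F.suc F.zero} _ b≢c = ⊥-elim (b≢c refl)
alternate {F.zero} {F.suc F.zero} {F.zero} _ _ = refl
alternate {F.suc F.zero} {F.zero} {F.suc F.zero} _ _ = refl

alternating-even : (g : ℕ → Fin 2) → (∀ x → g x ≢ g (suc x)) → ∀ j → g (2 * j) ≡ g 0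
alternating-even g change zero = refl
alternating-even g change (suc j) = begin
  g (2 * suc j)         ≡⟨ cong g (*-suc 2 j) ⟩
  g (suc (suc (2 * j))) ≡⟨ alternate (change (2 * j)) (change (suc (2 * j))) ⟨
  g (2 * j)             ≡⟨ alternating-even g change j ⟩
  g 0                   ∎
  where open ≡-Reasoning

colour-separates : ∀ {n k} {E : EdgeList n} (c : Fin n → Fin k)
  → (∀ {u v} → (u , v) ∈ E → c u ≢ c v) → ∀ {u v} → Adj E u v → c u ≢ c v
colour-separates c proper (inj₁ uv) = proper uv
colour-separates c proper (inj₂ vu) = λ e → proper vu (sym e)

-- An odd cycle all of whose edges lie in E' prevents E' from being
-- 2-colourable: the colours along the cycle would alternate an odd number of
-- times around it.
odd-cycle-not-bipartite : ∀ {n} {E : EdgeList n} (C : Cycle E) → Odd (len C)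
  → (E' : EdgeList n) → Colorable 2 E' → (∀ i → Adj E' (vert C i) (vert C (next i))) → ⊥
odd-cycle-not-bipartite C (j , L≡) E' (c , proper) edges-in = change (2 * j) (begin
    g (2 * j)       ≡⟨ alternating-even g change j ⟩
    g 0             ≡⟨ cong c (at-periodic 0) ⟨
    g L             ≡⟨ cong g L≡ ⟩
    g (suc (2 * j)) ∎)
  where
    open CycleWalk C
    open ≡-Reasoning
    g : ℕ → Fin 2
    g x = c (at x)
    change : ∀ x → g x ≢ g (suc x)
    change x = colour-separates c proper (subst (Adj E' (at x)) (next-at x) (edges-in (x mod L)))

module ClosedWalk {n : ℕ} {E : EdgeList n} (K : ℕ) (K≥3 : 3 ≤ K) (q : ℕ → Fin n)
  (closed : q K ≡ q 0)
  (distinct : ∀ t t' → t < K → t' < K → q t ≡ q t' → t ≡ t')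
  (adjacent : ∀ t → t < K → Adj E (q t) (q (suc t))) where

  excess : ℕ
  excess = K ∸ 3

  size : 3 + excess ≡ K
  size = m+[n∸m]≡n K≥3

  private
    bound : ∀ (i : Fin (3 + excess)) → toℕ i < K
    bound i = subst (toℕ i <_) size (toℕ<n i)

    position : ∀ {t} → t < K → Fin (3 + excess)
    position t<K = F.fromℕ< (subst (_ <_) (sym size) t<K)

    toℕ-position : ∀ {t} (t<K : t < K) → toℕ (position t<K) ≡ t
    toℕ-position t<K = toℕ-fromℕ< (subst (_ <_) (sym size) t<K)

    toℕ-next : ∀ (i : Fin (3 + excess)) → toℕ (next i) ≡ suc (toℕ i) % (3 + excess)
    toℕ-next i = toℕ-fromℕ< (m%n<n (suc (toℕ i)) (3 + excess))

    q-next : ∀ (i : Fin (3 + excess)) → q (toℕ (next i)) ≡ q (suc (toℕ i))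
    q-next i with suc (toℕ i) <? 3 + excess
    ... | yes i+1<K = cong q (trans (toℕ-next i) (m<n⇒m%n≡m i+1<K))
    ... | no i+1≮K = begin
        q (toℕ (next i)) ≡⟨ cong q (trans (toℕ-next i) (trans (cong (_% (3 + excess)) last) (n%n≡0 (3 + excess)))) ⟩
        q 0              ≡⟨ closed ⟨
        q K              ≡⟨ cong q (trans last size) ⟨
        q (suc (toℕ i))  ∎
      where
        open ≡-Reasoning
        last : suc (toℕ i) ≡ 3 + excess
        last = ≤-antisym (toℕ<n i) (≮⇒≥ i+1≮K)

  cycle : Cycle E
  cycle = record
    { m = excess
    ; vert = λ i → q (toℕ i)
    ; inj = λ {i} {j} e → toℕ-injective (distinct (toℕ i) (toℕ j) (bound i) (bound j) e)
    ; adj = λ i → subst (Adj E (q (toℕ i))) (sym (q-next i)) (adjacent (toℕ i) (bound i))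
    }

  vertex⁻ : ∀ {v} → CycV cycle v → ∃[ t ] (t < K × q t ≡ v)
  vertex⁻ (i , e) = toℕ i , bound i , e

  vertex⁺ : ∀ {t v} → t < K → q t ≡ v → CycV cycle v
  vertex⁺ t<K e = position t<K , trans (cong q (toℕ-position t<K)) e

  edge⁻ : ∀ {u v} → CycE cycle u v → ∃[ t ] (t < K × SamePair (q t) (q (suc t)) u v)
  edge⁻ (i , p) = toℕ i , bound i , same-pair-subst refl (q-next i) p

  edge⁺ : ∀ {t u v} → t < K → SamePair (q t) (q (suc t)) u v → CycE cycle u v
  edge⁺ {t} t<K p = position t<K ,
    same-pair-subst (cong q (sym (toℕ-position t<K)))
                    (sym (trans (q-next (position t<K)) (cong (λ z → q (suc z)) (toℕ-position t<K)))) p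

record Ear {n : ℕ} {E : EdgeList n} (C : Cycle E) : Set where
  field
    steps      : ℕ
    nontrivial : 1 ≤ steps
    path       : ℕ → Fin n
    simple     : ∀ t t' → t ≤ steps → t' ≤ steps → path t ≡ path t' → t ≡ t'
    walk       : ∀ t → t < steps → Adj E (path t) (path (suc t))
    inner-off  : ∀ t → 0 < t → t < steps → ¬ CycV C (path t)
    edges-off  : ∀ t → t < steps → ¬ CycE C (path t) (path (suc t))
    start-on   : CycV C (path 0)
    end-on     : CycV C (path steps)

∸-suc : ∀ {r t} → t < r → r ∸ t ≡ suc (r ∸ suc t)
∸-suc {suc r} {zero} _ = refl
∸-suc {suc r} {suc t} (s≤s t<r) = ∸-suc t<r

adj-sym : ∀ {n} {E : EdgeList n} {u v} → Adj E u v → Adj E v u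
adj-sym (inj₁ uv) = inj₂ uv
adj-sym (inj₂ vu) = inj₁ vu

reverse-ear : ∀ {n} {E : EdgeList n} {C : Cycle E} → Ear C → Ear C
reverse-ear {n} {E} {C} P = record
  { steps      = steps
  ; nontrivial = nontrivial
  ; path       = back
  ; simple     = λ t t' t≤ t'≤ e →
      ∸-cancelˡ-≡ t≤ t'≤ (simple (steps ∸ t) (steps ∸ t') (m∸n≤m steps t) (m∸n≤m steps t') e)
  ; walk       = λ t t< →
      subst (λ z → Adj E (path z) (back (suc t))) (sym (∸-suc t<)) (adj-sym (walk (steps ∸ suc t) (earlier t<)))
  ; inner-off  = λ t 0<t t< →
      inner-off (steps ∸ t) (subst (0 <_) (sym (∸-suc t<)) (s≤s z≤n)) (∸-monoʳ-< 0<t (<⇒≤ t<))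
  ; edges-off  = λ t t< e →
      edges-off (steps ∸ suc t) (earlier t<)
        (edge-sym C (subst (λ z → CycE C (path z) (back (suc t))) (∸-suc t<) e))
  ; start-on   = end-on
  ; end-on     = subst (CycV C) (cong path (sym (n∸n≡0 steps))) start-on
  }
  where
    open Ear P
    back : ℕ → Fin n
    back t = path (steps ∸ t)
    earlier : ∀ {t} → t < steps → steps ∸ suc t < steps
    earlier {t} t< = subst (_≤ steps) (∸-suc t<) (m∸n≤m steps t)

-- Suppose the ear runs from p 0 = at (s + ℓ)
-- to p r = at s, where 1 ≤ ℓ = 1 + ℓ₀ < L.  Then
--   q = p 0, …, p r = at s, at (s + 1), …, at (s + ℓ) = p 0
-- is a closed walk of length K = r + ℓ.
module CloseEar {n : ℕ} {E : EdgeList n} (C : Cycle E) (P : Ear C) (s ℓ₀ : ℕ)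
  (arc<L : suc ℓ₀ < len C)
  (start : Ear.path P 0 ≡ CycleWalk.at C (s + suc ℓ₀))
  (end : Ear.path P (Ear.steps P) ≡ CycleWalk.at C s)
  (odd : Odd (Ear.steps P + suc ℓ₀)) where

  open CycleWalk C
  open Ear P renaming (steps to r; path to p)

  ℓ : ℕ
  ℓ = suc ℓ₀

  K : ℕ
  K = r + ℓ

  q : ℕ → Fin n
  q t with t ≤? r
  ... | yes _ = p t
  ... | no _ = at (s + (t ∸ r))

  q-ear : ∀ {t} → t ≤ r → q t ≡ p t
  q-ear {t} t≤r with t ≤? r
  ... | yes _ = refl
  ... | no t≰r = ⊥-elim (t≰r t≤r)

  q-arc : ∀ {t} → r ≤ t → q t ≡ at (s + (t ∸ r))
  q-arc {t} r≤t with t ≤? r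
  ... | no _ = refl
  ... | yes t≤r = begin
      p t              ≡⟨ cong p t≡r ⟩
      p r              ≡⟨ end ⟩
      at s             ≡⟨ cong at (+-identityʳ s) ⟨
      at (s + 0)       ≡⟨ cong (λ z → at (s + z)) (trans (cong (_∸ r) t≡r) (n∸n≡0 r)) ⟨
      at (s + (t ∸ r)) ∎
    where
      open ≡-Reasoning
      t≡r : t ≡ r
      t≡r = ≤-antisym t≤r r≤t

  q-arc-suc : ∀ {t} → r ≤ t → q (suc t) ≡ at (s + suc (t ∸ r))
  q-arc-suc {t} r≤t = trans (q-arc (m≤n⇒m≤1+n r≤t)) (cong (λ z → at (s + z)) (+-∸-assoc 1 r≤t))

  q-arc-at : ∀ x → q (r + x) ≡ at (s + x)
  q-arc-at x = trans (q-arc (m≤m+n r x)) (cong (λ z → at (s + z)) (m+n∸m≡n r x))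

  arc-offset< : ∀ {t} → t < K → t ∸ r < ℓ
  arc-offset< {t} t<K = m<n+o⇒m∸n<o t r t<K

  arc-on-C : ∀ {t} → r ≤ t → CycV C (q t)
  arc-on-C {t} r≤t = subst (CycV C) (sym (q-arc r≤t)) (position-vertex (s + (t ∸ r)))

  ear-part-on-C : ∀ t → t < r → CycV C (q t) → q t ≡ at (s + ℓ)
  ear-part-on-C zero _ _ = trans (q-ear z≤n) start
  ear-part-on-C (suc t) t<r on =
    ⊥-elim (inner-off (suc t) (s≤s z≤n) t<r (subst (CycV C) (q-ear (<⇒≤ t<r)) on))

  ear-avoids-arc : ∀ t t' → t < r → r ≤ t' → t' < K → q t ≢ q t'
  ear-avoids-arc t t' t<r r≤t' t'<K e = <-irrefl offset≡ℓ (arc-offset< t'<K)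
    where
      offset≡ℓ : t' ∸ r ≡ ℓ
      offset≡ℓ = at-injective s (t' ∸ r) ℓ (<-trans (arc-offset< t'<K) arc<L) arc<L
        (trans (sym (q-arc r≤t')) (trans (sym e) (ear-part-on-C t t<r (subst (CycV C) (sym e) (arc-on-C r≤t')))))

  -- the first K vertices of q are distinct: the ear and the arc are each
  -- simple, and they meet only at their common ends
  q-distinct : ∀ t t' → t < K → t' < K → q t ≡ q t' → t ≡ t'
  q-distinct = injective-by-symmetry q (_< K) ordered
    where
      ordered : ∀ t t' → t ≤ t' → t < K → t' < K → q t ≡ q t' → t ≡ t'
      ordered t t' t≤t' t<K t'<K e with ≤-<-connex t' r | ≤-<-connex r t
      ... | inj₁ t'≤r | _ =
        simple t t' (≤-trans t≤t' t'≤r) t'≤r (trans (sym (q-ear (≤-trans t≤t' t'≤r))) (trans e (q-ear t'≤r)))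
      ... | inj₂ r<t' | inj₁ r≤t = ∸-cancelʳ-≡ r≤t (<⇒≤ r<t')
        (at-injective s (t ∸ r) (t' ∸ r) (<-trans (arc-offset< t<K) arc<L) (<-trans (arc-offset< t'<K) arc<L)
          (trans (sym (q-arc r≤t)) (trans e (q-arc (<⇒≤ r<t')))))
      ... | inj₂ r<t' | inj₂ t<r = ⊥-elim (ear-avoids-arc t t' t<r (<⇒≤ r<t') t'<K e)

  q-adjacent : ∀ t → t < K → Adj E (q t) (q (suc t))
  q-adjacent t _ with ≤-<-connex r t
  ... | inj₁ r≤t = subst₂ (Adj E) (sym (q-arc r≤t))
                     (sym (trans (q-arc-suc r≤t) (cong at (+-suc s (t ∸ r))))) (at-adj (s + (t ∸ r)))
  ... | inj₂ t<r = subst₂ (Adj E) (sym (q-ear (<⇒≤ t<r))) (sym (q-ear t<r)) (walk t t<r)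

  q-closed : q K ≡ q 0
  q-closed = trans (q-arc-at ℓ) (trans (sym start) (sym (q-ear z≤n)))

  module Q = ClosedWalk K (odd-≥3 odd (+-mono-≤ nontrivial (s≤s (z≤n {ℓ₀})))) q q-closed q-distinct q-adjacent

  cycle-odd : Odd (len Q.cycle)
  cycle-odd = subst Odd (sym Q.size) odd

  arc : Fin (suc ℓ) → Fin n
  arc j = at (s + toℕ j)

  toℕ≤ℓ : ∀ (j : Fin (suc ℓ)) → toℕ j ≤ ℓ
  toℕ≤ℓ j = s≤s⁻¹ (toℕ<n j)

  arc-injective : ∀ {j j'} → arc j ≡ arc j' → j ≡ j'
  arc-injective {j} {j'} e =
    toℕ-injective (at-injective s (toℕ j) (toℕ j') (≤-<-trans (toℕ≤ℓ j) arc<L) (≤-<-trans (toℕ≤ℓ j') arc<L) e)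

  -- the common vertices of C and Q are the vertices of the arc, since the
  -- inner vertices of the ear avoid C
  arc-vertices : ∀ v → (CycV C v × CycV Q.cycle v) ⇔ (∃[ j ] (arc j ≡ v))
  arc-vertices v = mk⇔ to from
    where
      to : CycV C v × CycV Q.cycle v → ∃[ j ] (arc j ≡ v)
      to (v∈C , v∈Q) with Q.vertex⁻ v∈Q
      ... | t , t<K , qt≡v with ≤-<-connex r t
      ...   | inj₁ r≤t = F.fromℕ< j<1+ℓ ,
                trans (cong (λ z → at (s + z)) (toℕ-fromℕ< j<1+ℓ)) (trans (sym (q-arc r≤t)) qt≡v)
        where
          j<1+ℓ : t ∸ r < suc ℓ
          j<1+ℓ = m<n⇒m<1+n (arc-offset< t<K)
      ...   | inj₂ t<r = F.fromℕ ℓ ,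
                trans (cong (λ z → at (s + z)) (toℕ-fromℕ ℓ))
                      (trans (sym (ear-part-on-C t t<r (subst (CycV C) (sym qt≡v) v∈C))) qt≡v)
      from : ∃[ j ] (arc j ≡ v) → CycV C v × CycV Q.cycle v
      from (j , arc≡v) = subst (CycV C) arc≡v (position-vertex (s + toℕ j)) , on-Q (m≤n⇒m<n∨m≡n (toℕ≤ℓ j))
        where
          on-Q : toℕ j < ℓ ⊎ toℕ j ≡ ℓ → CycV Q.cycle v
          on-Q (inj₁ j<ℓ) = Q.vertex⁺ (+-monoʳ-< r j<ℓ) (trans (q-arc-at (toℕ j)) arc≡v)
          on-Q (inj₂ j≡ℓ) = Q.vertex⁺ (≤-trans nontrivial (m≤m+n r ℓ))
            (trans (q-ear z≤n) (trans start (trans (cong (λ z → at (s + z)) (sym j≡ℓ)) arc≡v)))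

  arc-step : ∀ (j : Fin ℓ) → arc (F.inject₁ j) ≡ at (s + toℕ j)
  arc-step j = cong (λ z → at (s + z)) (toℕ-inject₁ j)

  -- the common edges of C and Q are the steps of the arc, since no edge of
  -- the ear lies on C
  arc-edges : ∀ u v → (CycE C u v × CycE Q.cycle u v) ⇔ (∃[ j ] SamePair (arc (F.inject₁ j)) (arc (F.suc j)) u v)
  arc-edges u v = mk⇔ to from
    where
      to : CycE C u v × CycE Q.cycle u v → ∃[ j ] SamePair (arc (F.inject₁ j)) (arc (F.suc j)) u v
      to (uv∈C , uv∈Q) with Q.edge⁻ uv∈Q
      ... | t , t<K , joins with ≤-<-connex r t
      ...   | inj₁ r≤t = F.fromℕ< (arc-offset< t<K) ,
                same-pair-subst (trans (q-arc r≤t) (sym (trans (arc-step j) (cong (λ z → at (s + z)) toℕj≡))))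
                                (trans (q-arc-suc r≤t) (cong (λ z → at (s + suc z)) (sym toℕj≡))) joins
        where
          j : Fin ℓ
          j = F.fromℕ< (arc-offset< t<K)
          toℕj≡ : toℕ j ≡ t ∸ r
          toℕj≡ = toℕ-fromℕ< (arc-offset< t<K)
      ...   | inj₂ t<r = ⊥-elim (edges-off t t<r (subst₂ (CycE C) (q-ear (<⇒≤ t<r)) (q-ear t<r)
                  (edge-of-pair C (same-pair-sym joins) uv∈C)))
        where
          same-pair-sym : ∀ {x y a b : Fin n} → SamePair x y a b → SamePair a b x y
          same-pair-sym (inj₁ (refl , refl)) = inj₁ (refl , refl)
          same-pair-sym (inj₂ (refl , refl)) = inj₂ (refl , refl)
      from : ∃[ j ] SamePair (arc (F.inject₁ j)) (arc (F.suc j)) u v → CycE C u v × CycE Q.cycle u v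
      from (j , joins) =
          step-edge (s + toℕ j) (same-pair-subst (arc-step j) (cong at (+-suc s (toℕ j))) joins)
        , Q.edge⁺ (+-monoʳ-< r (toℕ<n j))
            (same-pair-subst (trans (arc-step j) (sym (q-arc-at (toℕ j))))
                             (trans (sym (q-arc-at (suc (toℕ j)))) (cong q (+-suc r (toℕ j)))) joins)

  meets : IntersectionIsNontrivialPath C Q.cycle
  meets = ℓ₀ , arc , arc-injective , arc-vertices , arc-edges

close-ear : ∀ {n} {E : EdgeList n} (C : Cycle E) → Odd (len C) → (P : Ear C) → ∀ s ℓ → 1 ≤ ℓ → ℓ < len C
  → Ear.path P 0 ≡ CycleWalk.at C (s + ℓ) → Ear.path P (Ear.steps P) ≡ CycleWalk.at C s
  → Odd (Ear.steps P + ℓ) → OddCyclesMeetInPath E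
close-ear C oddC P s (suc ℓ₀) _ ℓ<L start end odd = (C , oddC) , (Q.cycle , cycle-odd) , meets
  where open CloseEar C P s ℓ₀ ℓ<L start end odd

ear-arc : ∀ {n} {E : EdgeList n} (C : Cycle E) (P : Ear C) → let open CycleWalk C; open Ear P in
  ∃[ s ] ∃[ ℓ ] (1 ≤ ℓ × ℓ < L × path 0 ≡ at (s + ℓ) × path steps ≡ at s)
ear-arc C P with vertex-position start-on | vertex-position end-on
  where open CycleWalk C; open Ear P
... | a , at-a | b , at-b with forward-step b a
  where open CycleWalk C
...   | ℓ , ℓ<L , b+ℓ≡a = b , ℓ , n≢0⇒n>0 ℓ≢0 , ℓ<L , start≡ , sym at-b
  where
    open CycleWalk C
    open Ear P
    start≡ : path 0 ≡ at (b + ℓ)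
    start≡ = trans (sym at-a) (at-cong a (b + ℓ) (sym b+ℓ≡a))
    ℓ≢0 : ℓ ≢ 0
    ℓ≢0 ℓ≡0 = <-irrefl (simple 0 steps z≤n ≤-refl ends≡) nontrivial
      where
        ends≡ : path 0 ≡ path steps
        ends≡ = trans start≡ (trans (cong (λ z → at (b + z)) ℓ≡0) (trans (cong at (+-identityʳ b)) at-b))

-- An odd cycle with an ear yields two odd cycles meeting in a nontrivial path:
-- of the two arcs cut off by the ends of the ear, one closes it into an odd cycle.
ear⇒meeting : ∀ {n} {E : EdgeList n} (C : Cycle E) → Odd (len C) → Ear C → OddCyclesMeetInPath E
ear⇒meeting C oddC P with ear-arc C P
... | s , ℓ , 1≤ℓ , ℓ<L , start , end
  with odd-split (r + ℓ) (r + (L ∸ ℓ)) (two-routes-odd r ℓ L (<⇒≤ ℓ<L) oddC)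
  where open CycleWalk C; open Ear P renaming (steps to r)
...   | inj₁ odd = close-ear C oddC P s ℓ 1≤ℓ ℓ<L start end odd
...   | inj₂ odd = close-ear C oddC (reverse-ear P) (s + ℓ) (L ∸ ℓ) (m<n⇒0<n∸m ℓ<L)
                     (∸-monoʳ-< 1≤ℓ (<⇒≤ ℓ<L)) start' end' odd
  where
    open CycleWalk C
    open Ear P renaming (steps to r; path to p)
    open ≡-Reasoning
    start' : p r ≡ at (s + ℓ + (L ∸ ℓ))
    start' = begin
      p r                   ≡⟨ end ⟩
      at s                  ≡⟨ at-periodic s ⟨
      at (s + L)            ≡⟨ cong (λ z → at (s + z)) (m+[n∸m]≡n (<⇒≤ ℓ<L)) ⟨
      at (s + (ℓ + (L ∸ ℓ))) ≡⟨ cong at (+-assoc s ℓ (L ∸ ℓ)) ⟨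
      at (s + ℓ + (L ∸ ℓ))  ∎
    end' : p (r ∸ r) ≡ at (s + ℓ)
    end' = trans (cong p (n∸n≡0 r)) start

least : (P : ℕ → Set) → (∀ y → Dec (P y)) → ∀ N → P N
  → ∃[ y ] (y ≤ N × P y × (∀ z → z < y → ¬ P z))
least P P? zero p0 = 0 , z≤n , p0 , λ _ ()
least P P? (suc N) pN with P? 0
... | yes p0 = 0 , z≤n , p0 , λ _ ()
... | no ¬p0 with least (λ y → P (suc y)) (λ y → P? (suc y)) N pN
...   | y , y≤N , py , below = suc y , s≤s y≤N , py , minimal
  where
    minimal : ∀ z → z < suc y → ¬ P z
    minimal zero _ = ¬p0
    minimal (suc z) (s≤s z<y) = below z z<y

module _ {n : ℕ} {E : EdgeList n} (C D : Cycle E) where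

  open CycleWalk D

  stretch-ear : ∀ w j → suc j < L → CycV C (at w) → CycV C (at (w + suc j))
    → (∀ z → z < j → ¬ CycV C (at (w + suc z))) → ¬ CycE C (at w) (at (suc w)) → Ear C
  stretch-ear w j short w-on end-on away first-off = record
    { steps      = suc j
    ; nontrivial = s≤s z≤n
    ; path       = λ t → at (w + t)
    ; simple     = λ t t' t≤ t'≤ → at-injective w t t' (≤-<-trans t≤ short) (≤-<-trans t'≤ short)
    ; walk       = λ t _ → subst (Adj E (at (w + t))) (cong at (sym (+-suc w t))) (at-adj (w + t))
    ; inner-off  = inner-off
    ; edges-off  = edges-off
    ; start-on   = subst (CycV C) (cong at (sym (+-identityʳ w))) w-on
    ; end-on     = end-on
    }
    where
      inner-off : ∀ t → 0 < t → t < suc j → ¬ CycV C (at (w + t))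
      inner-off (suc z) _ (s≤s z<j) = away z z<j
      edges-off : ∀ t → t < suc j → ¬ CycE C (at (w + t)) (at (w + suc t))
      edges-off zero _ e = first-off (subst₂ (CycE C) (cong at (+-identityʳ w))
                                       (cong at (trans (+-suc w 0) (cong suc (+-identityʳ w)))) e)
      edges-off (suc t) t<1+j e = inner-off (suc t) (s≤s z≤n) t<1+j (proj₁ (edge-ends C e))

  private
    Leaves : ℕ → Set
    Leaves y = ¬ CycE C (at y) (at (suc y))

    Leaves? : ∀ y → Dec (Leaves y)
    Leaves? y = ¬? (CycE? C (at y) (at (suc y)))

    leaves-within-period : ∀ t₀ → Leaves t₀ → ∀ s → ∃[ d ] (d < L × Leaves (s + d))
    leaves-within-period t₀ off s with forward-step s t₀
    ... | d , d<L , s+d≡t₀ = d , d<L , λ e → off (subst₂ (CycE C) (at-cong (s + d) t₀ s+d≡t₀)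
                                                      (at-cong (suc (s + d)) (suc t₀) (suc-cong (s + d) t₀ s+d≡t₀)) e)

    departure-on-C : ∀ s → CycV C (at s) → ∀ i → (∀ j → j < i → ¬ Leaves (s + j)) → CycV C (at (s + i))
    departure-on-C s s-on zero _ = subst (CycV C) (cong at (sym (+-identityʳ s))) s-on
    departure-on-C s _ (suc i) stays = subst (CycV C) (cong at (sym (+-suc s i)))
      (proj₂ (edge-ends C (decidable-stable (CycE? C (at (s + i)) (at (suc (s + i)))) (stays i ≤-refl))))

    -- after the departure point w = s + i (i < L), D is back on C within a period:
    -- at s + 1 if i = 0, and at s + L otherwise
    return-point : ∀ s i → i < L → CycV C (at s) → CycV C (at (suc s))
      → ∃[ z ] (suc z < L × CycV C (at (s + i + suc z)))
    return-point s zero _ _ s+1-on = 0 , s≤s (s≤s z≤n) ,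
      subst (CycV C) (cong at (sym (trans (+-comm (s + 0) 1) (cong suc (+-identityʳ s))))) s+1-on
    return-point s (suc i) i<L s-on _ = L ∸ suc (suc i) , gap<L ,
      subst (CycV C) (cong at (sym lands)) (subst (CycV C) (sym (at-periodic s)) s-on)
      where
        open ≡-Reasoning
        gap : suc (L ∸ suc (suc i)) ≡ L ∸ suc i
        gap = sym (∸-suc i<L)
        gap<L : suc (L ∸ suc (suc i)) < L
        gap<L = subst (_< L) (sym gap) (∸-monoʳ-< (s≤s z≤n) (<⇒≤ i<L))
        lands : s + suc i + suc (L ∸ suc (suc i)) ≡ s + L
        lands = begin
          s + suc i + suc (L ∸ suc (suc i)) ≡⟨ cong (s + suc i +_) gap ⟩
          s + suc i + (L ∸ suc i)           ≡⟨ +-assoc s (suc i) (L ∸ suc i) ⟩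
          s + (suc i + (L ∸ suc i))         ≡⟨ cong (s +_) (m+[n∸m]≡n (<⇒≤ i<L)) ⟩
          s + L                             ∎

  -- If D has a step off C and a step with both ends on C, then D contains an
  -- ear of C: from the latter step walk along D to the first step w leaving C,
  -- and on to the first vertex after w that is on C again.
  find-ear : (∃[ t ] ¬ CycE C (at t) (at (suc t))) → (∃[ s ] (CycV C (at s) × CycV C (at (suc s)))) → Ear C
  find-ear (t₀ , off) (s , s-on , s+1-on) with leaves-within-period t₀ off s
  ... | d , d<L , leaves-d with least (λ i → Leaves (s + i)) (λ i → Leaves? (s + i)) d leaves-d
  ...   | i , i≤d , leaves-i , stays with return-point s i (≤-<-trans i≤d d<L) s-on s+1-on
  ...     | z , z<L , z-on with least (λ j → CycV C (at (s + i + suc j))) (λ j → CycV? C (at (s + i + suc j))) z z-on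
  ...       | j , j≤z , j-on , away =
    stretch-ear (s + i) j (≤-<-trans (s≤s j≤z) z<L) (departure-on-C s s-on i stays) j-on away leaves-i

module _ {n : ℕ} {E : EdgeList n} where

  edges-included : (X Y : Cycle E) → ¬ (∃[ i ] ¬ CycE Y (vert X i) (vert X (next i)))
    → ∀ {u v} → CycE X u v → CycE Y u v
  edges-included X Y none (i , p) =
    edge-of-pair Y p (decidable-stable (CycE? Y (vert X i) (vert X (next i))) (λ off → none (i , off)))

  distinct-cycles-differ : (X Y : Cycle E) → ¬ SameSubgraph X Y
    → (∃[ t ] ¬ CycE X (CycleWalk.at Y t) (CycleWalk.at Y (suc t)))
    ⊎ (∃[ t ] ¬ CycE Y (CycleWalk.at X t) (CycleWalk.at X (suc t)))
  distinct-cycles-differ X Y X≠Y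
    with any? (λ i → ¬? (CycE? X (vert Y i) (vert Y (next i))))
       | any? (λ i → ¬? (CycE? Y (vert X i) (vert X (next i))))
  ... | yes (i , off) | _ = inj₁ (toℕ i , subst (λ z → ¬ CycE X z (vert Y (next i))) (CycleWalk.vert-at Y i) off)
  ... | _ | yes (i , off) = inj₂ (toℕ i , subst (λ z → ¬ CycE Y z (vert X (next i))) (CycleWalk.vert-at X i) off)
  ... | no Y-in-X | no X-in-Y = ⊥-elim (X≠Y λ u v → mk⇔ (edges-included X Y X-in-Y) (edges-included Y X Y-in-X))

  shared-edge-step : (X Y : Cycle E) → ∀ {u v} → CycE X u v → CycE Y u v
    → ∃[ s ] (CycV X (CycleWalk.at Y s) × CycV X (CycleWalk.at Y (suc s)))
  shared-edge-step X Y uv∈X uv∈Y with CycleWalk.edge-step Y uv∈Y | edge-ends X uv∈X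
  ... | s , inj₁ (s≡u , s+1≡v) | u∈X , v∈X = s , subst (CycV X) (sym s≡u) u∈X , subst (CycV X) (sym s+1≡v) v∈X
  ... | s , inj₂ (s≡v , s+1≡u) | u∈X , v∈X = s , subst (CycV X) (sym s≡v) v∈X , subst (CycV X) (sym s+1≡u) u∈X

  -- Two distinct odd cycles sharing an edge yield two odd cycles meeting in a
  -- nontrivial path: one of them has an ear on the other.
  shared-edge⇒meeting : (X Y : OddCycle E) → ¬ SameSubgraph (proj₁ X) (proj₁ Y)
    → ∀ {u v} → CycE (proj₁ X) u v → CycE (proj₁ Y) u v → OddCyclesMeetInPath E
  shared-edge⇒meeting (X , odd-X) (Y , odd-Y) X≠Y uv∈X uv∈Y with distinct-cycles-differ X Y X≠Y
  ... | inj₁ Y-leaves-X = ear⇒meeting X odd-X (find-ear X Y Y-leaves-X (shared-edge-step X Y uv∈X uv∈Y))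
  ... | inj₂ X-leaves-Y = ear⇒meeting Y odd-Y (find-ear Y X X-leaves-Y (shared-edge-step Y X uv∈Y uv∈X))

module _ {A : Set} where

  ∈-removeAt⁺ : ∀ {x : A} (xs : List A) (i : Fin (length xs)) → x ∈ xs → x ≢ lookup xs i → x ∈ removeAt xs i
  ∈-removeAt⁺ (y ∷ ys) F.zero (here x≡y) x≢y = ⊥-elim (x≢y x≡y)
  ∈-removeAt⁺ (y ∷ ys) F.zero (there x∈ys) _ = x∈ys
  ∈-removeAt⁺ (y ∷ ys) (F.suc i) (here x≡y) _ = here x≡y
  ∈-removeAt⁺ (y ∷ ys) (F.suc i) (there x∈ys) x≢ = there (∈-removeAt⁺ ys i x∈ys x≢)

  ∈-removeAt⁻ : ∀ {x : A} (xs : List A) (i : Fin (length xs)) → x ∈ removeAt xs i → x ∈ xs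
  ∈-removeAt⁻ (y ∷ ys) F.zero x∈ = there x∈
  ∈-removeAt⁻ (y ∷ ys) (F.suc i) (here x≡y) = here x≡y
  ∈-removeAt⁻ (y ∷ ys) (F.suc i) (there x∈) = there (∈-removeAt⁻ ys i x∈)

  sublist-full : ∀ {xs ys : List A} → xs ⊆ ys → length ys ≤ length xs → ∀ {x} → x ∈ ys → x ∈ xs
  sublist-full {xs} sub long {x} x∈ys =
    subst (x ∈_) (sym (Pointwise-≡⇒≡ (toPointwise (≤-antisym (length-mono-≤ sub) long) sub))) x∈ys

  sublist-but-one : ∀ {xs ys : List A} → xs ⊆ ys → length ys ∸ length xs < 2
    → (∀ {x} → x ∈ ys → x ∈ xs) ⊎ (∃[ f ] (∀ {x} → x ∈ ys → x ≢ f → x ∈ xs))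
  sublist-but-one [] _ = inj₁ (λ ())
  sublist-but-one {xs} {y ∷ ys} (.y ∷ʳ sub) missing = inj₂ (y , only-y)
    where
      missing' : suc (length ys ∸ length xs) < 2
      missing' = subst (_< 2) (+-∸-assoc 1 (length-mono-≤ sub)) missing
      only-y : ∀ {x} → x ∈ y ∷ ys → x ≢ y → x ∈ xs
      only-y (here x≡y) x≢y = ⊥-elim (x≢y x≡y)
      only-y (there x∈ys) _ = sublist-full sub (m∸n≡0⇒m≤n (n<1⇒n≡0 (s≤s⁻¹ missing'))) x∈ys
  sublist-but-one (refl ∷ sub) missing with sublist-but-one sub missing
  ... | inj₁ all = inj₁ λ { (here x≡y) → here x≡y ; (there x∈) → there (all x∈) }
  ... | inj₂ (f , but-f) = inj₂ (f , λ { (here x≡y) _ → here x≡y ; (there x∈) x≢f → there (but-f x∈ x≢f) })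

colourable-sub : ∀ {n k} {E E' : EdgeList n} → (∀ {x} → x ∈ E' → x ∈ E) → Colorable k E → Colorable k E'
colourable-sub sub (c , proper) = c , λ uv∈E' → proper (sub uv∈E')

colourable-≤2 : ∀ {n k} {E : EdgeList n} → k ≤ 2 → Colorable k E → Colorable 2 E
colourable-≤2 k≤2 (c , proper) = (λ v → F.inject≤ (c v) k≤2) , λ uv e → proper uv (inject≤-injective k≤2 k≤2 _ _ e)

-- Deleting edge number i of a (3,2)-critical graph and then at most one
-- further edge f leaves a 2-colourable graph: es_χ(G - e) < 2, and
-- χ(G - e) ≤ χ(G) = 3.
critical-bipartite-after-two : ∀ {n} {E : EdgeList n} → Critical32 E → (i : Fin (length E))
  → ∃[ E₁ ] (Colorable 2 E₁ × ∃[ f ] (∀ {x} → x ∈ removeAt E i → x ≢ f → x ∈ E₁))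
critical-bipartite-after-two {E = E} (χ≡3 , _ , drop) i with drop i
... | m , ((E₁ , (E₁⊆R , k , χR≡k , χE₁≡k-1) , removed≡m) , _) , m<2 =
  E₁ , colourable-≤2 (∸-monoˡ-≤ 1 k≤3) (proj₁ χE₁≡k-1) , spare
  where
    k≤3 : k ≤ 3
    k≤3 = proj₂ χR≡k 3 (colourable-sub (λ {x} → ∈-removeAt⁻ E i) (proj₁ χ≡3))
    spare : ∃[ f ] (∀ {x} → x ∈ removeAt E i → x ≢ f → x ∈ E₁)
    spare with sublist-but-one E₁⊆R (subst (_< 2) (sym removed≡m) m<2)
    ... | inj₁ all = lookup E i , λ x∈R _ → all x∈R
    ... | inj₂ one = one

Adj? : ∀ {n} (E : EdgeList n) u v → Dec (Adj E u v)
Adj? E u v = ((u , v) ∈? E) ⊎-dec ((v , u) ∈? E)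
  where open import Data.List.Membership.DecPropositional (≡-dec F._≟_ F._≟_) using (_∈?_)

odd-cycle-escapes : ∀ {n} {E : EdgeList n} (C : Cycle E) → Odd (len C) → (E₁ : EdgeList n) → Colorable 2 E₁
  → ∃[ t ] ¬ Adj E₁ (vert C t) (vert C (next t))
odd-cycle-escapes C odd-C E₁ col with all? (λ t → Adj? E₁ (vert C t) (vert C (next t)))
... | yes inside = ⊥-elim (odd-cycle-not-bipartite C odd-C E₁ col inside)
... | no not-inside = ¬∀⟶∃¬ _ _ (λ t → Adj? E₁ (vert C t) (vert C (next t))) not-inside

edge-position : ∀ {n} {E : EdgeList n} {u v} → Adj E u v
  → ∃[ i ] (lookup E i ≡ (u , v) ⊎ lookup E i ≡ (v , u))
edge-position (inj₁ uv∈E) = index uv∈E , inj₁ (sym (lookup-index uv∈E))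
edge-position (inj₂ vu∈E) = index vu∈E , inj₂ (sym (lookup-index vu∈E))

cycle-survives-removal : ∀ {n} {E : EdgeList n} (C : Cycle E) {u v} → ¬ CycE C u v
  → (i : Fin (length E)) → (lookup E i ≡ (u , v) ⊎ lookup E i ≡ (v , u))
  → ∀ t → Adj (removeAt E i) (vert C t) (vert C (next t))
cycle-survives-removal {E = E} C {u} {v} off i i-is-uv t = survives (adj C t)
  where
    kept : ∀ {x y} → CycE C x y → (x , y) ≢ lookup E i
    kept xy∈C xy≡ = avoided i-is-uv
      where
        avoided : (lookup E i ≡ (u , v) ⊎ lookup E i ≡ (v , u)) → ⊥
        avoided (inj₁ uv) = off (subst₂ (CycE C) (cong proj₁ (trans xy≡ uv)) (cong proj₂ (trans xy≡ uv)) xy∈C)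
        avoided (inj₂ vu) = off (edge-sym C (subst₂ (CycE C) (cong proj₁ (trans xy≡ vu)) (cong proj₂ (trans xy≡ vu)) xy∈C))
    survives : Adj E (vert C t) (vert C (next t)) → Adj (removeAt E i) (vert C t) (vert C (next t))
    survives (inj₁ e) = inj₁ (∈-removeAt⁺ E i e (kept (t , inj₁ (refl , refl))))
    survives (inj₂ e) = inj₂ (∈-removeAt⁺ E i e (kept (t , inj₂ (refl , refl))))

-- In a (3,2)-critical graph, for every edge e = {u , v} there is an edge f
-- through which every odd cycle avoiding e passes: such a cycle lies in G - e
-- and cannot lie in the 2-colourable graph G - e - f.
hitting-edge : ∀ {n} {E : EdgeList n} → Critical32 E → ∀ {u v} → Adj E u v
  → ∃[ f ] (∀ (C : OddCycle E) → ¬ CycE (proj₁ C) u v → CycE (proj₁ C) (proj₁ f) (proj₂ f))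
hitting-edge {E = E} crit {u} {v} uv with edge-position uv
... | i , i-is-uv with critical-bipartite-after-two crit i
...   | E₁ , col , f , all-but-f = f , hits
  where
    forced : ∀ {x} → x ∈ removeAt E i → ¬ x ∈ E₁ → x ≡ f
    forced x∈R x∉E₁ = decidable-stable (≡-dec F._≟_ F._≟_ _ f) (λ x≢f → x∉E₁ (all-but-f x∈R x≢f))
    hits : ∀ (C : OddCycle E) → ¬ CycE (proj₁ C) u v → CycE (proj₁ C) (proj₁ f) (proj₂ f)
    hits (C , odd-C) off with odd-cycle-escapes C odd-C E₁ col
    ... | t , escapes with cycle-survives-removal C off i i-is-uv t
    ... | inj₁ e = t , inj₁ (cong proj₁ tf , cong proj₂ tf)
      where tf = forced e (λ e₁ → escapes (inj₁ e₁))
    ... | inj₂ e = t , inj₂ (cong proj₂ ft , cong proj₁ ft)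
      where ft = forced e (λ e₁ → escapes (inj₂ e₁))

lemma2p5 : ∀ {n : ℕ} (E : EdgeList n) → IsGraph E → Critical32 E
    → Σ (OddCycle E) (λ C₁ → Σ (OddCycle E) (λ C₂ → Σ (OddCycle E) (λ C₃ →
           ¬ SameSubgraph (proj₁ C₁) (proj₁ C₂)
         × ¬ SameSubgraph (proj₁ C₁) (proj₁ C₃)
         × ¬ SameSubgraph (proj₁ C₂) (proj₁ C₃))))
    → Σ (OddCycle E) (λ D₁ → Σ (OddCycle E) (λ D₂ →
         IntersectionIsNontrivialPath (proj₁ D₁) (proj₁ D₂)))
lemma2p5 E _ crit (X₁ , X₂ , X₃ , X₁≠X₂ , X₁≠X₃ , X₂≠X₃) =
  by-cases (CycE? (proj₁ X₂) u v) (CycE? (proj₁ X₃) u v)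
  where
    u v : Fin _
    u = vert (proj₁ X₁) F.zero
    v = vert (proj₁ X₁) (next F.zero)
    e∈X₁ : CycE (proj₁ X₁) u v
    e∈X₁ = F.zero , inj₁ (refl , refl)
    f-hit : ∃[ f ] (∀ (C : OddCycle E) → ¬ CycE (proj₁ C) u v → CycE (proj₁ C) (proj₁ f) (proj₂ f))
    f-hit = hitting-edge crit (adj (proj₁ X₁) F.zero)
    by-cases : Dec (CycE (proj₁ X₂) u v) → Dec (CycE (proj₁ X₃) u v) → OddCyclesMeetInPath E
    by-cases (yes e∈X₂) _ = shared-edge⇒meeting X₁ X₂ X₁≠X₂ e∈X₁ e∈X₂
    by-cases (no _) (yes e∈X₃) = shared-edge⇒meeting X₁ X₃ X₁≠X₃ e∈X₁ e∈X₃
    by-cases (no e∉X₂) (no e∉X₃) =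
      shared-edge⇒meeting X₂ X₃ X₂≠X₃ (proj₂ f-hit X₂ e∉X₂) (proj₂ f-hit X₃ e∉X₃)
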